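{- Let $L$ be a complete lattice, $f\colon L\to L$ monotone, and $u\colon L\to L$ an $f$-compatible closure (i.e. $u$ is monotone, extensive, idempotent, and $u\circ f\sqsubseteq f\circ u$). Consider the Galois insertion $\langle u,i\rangle\colon L\to u(L)$ where $i\colon u(L)\to L$ is the inclusion. Then: (1) $f$ restricts to $u(L)$, i.e. $f(u(L))\subseteq u(L)$, giving $f_{|u(L)}\colon u(L)\to u(L)$; (2) $f_{|u(L)}$ is a sound and complete abstraction (with respect to the concretisation $i$) of both $f$ and $f\circ u$. Consequently $\nu f=i(\nu f_{|u(L)})=\nu(f\circ u)$. Moreover, if $u$ is continuous and strict then $\mu f=i(\mu f_{|u(L)})=\mu(f\circ u)$.
   Context: $u(L)=\{u(l)\mid l\in L\}$ is a complete lattice (the set of fixpoints of the closure $u$). For a monotone $h\colon L\to L$, $g\colon u(L)\to u(L)$ and the concretisation $i$, $g$ is a sound abstraction of $h$ if $h\circ i\sqsubseteq i\circ g$ and a complete abstraction if $i\circ g\sqsubseteq h\circ i$. $\mu,\nu$ denote least and greatest fixpoints. Continuous = preserves joins of directed sets; strict = maps $\bot$ to $\bot$. -}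

module Defs where

open import Level using (Level; suc; _⊔_; Lift)
open import Data.Empty using (⊥)
open import Data.Product using (Σ; ∃; _×_; _,_; proj₁)
open import Relation.Binary.Structures using (IsPartialOrder)

-- A complete lattice: a partial order (w.r.t. the setoid equality _≈_) with
-- joins ⋁ of arbitrary families indexed by types of level ℓ
-- (ℓ is also the level of the carrier, so every subset of the carrier,
-- seen as a Σ-type family, has a join).
record CompleteLattice (ℓ : Level) : Set (suc ℓ) where
  infix 4 _≈_ _≤_
  field
    Carrier        : Set ℓ
    _≈_            : Carrier → Carrier → Set ℓ
    _≤_            : Carrier → Carrier → Set ℓ
    isPartialOrder : IsPartialOrder _≈_ _≤_
    ⋁              : {I : Set ℓ} → (I → Carrier) → Carrier
    ⋁-upper        : {I : Set ℓ} (F : I → Carrier) (i : I) → F i ≤ ⋁ F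
    ⋁-least        : {I : Set ℓ} (F : I → Carrier) (z : Carrier) →
                     ((i : I) → F i ≤ z) → ⋁ F ≤ z

  ⊥L : Carrier
  ⊥L = ⋁ {I = Lift ℓ ⊥} (λ ())

module _ {ℓ : Level} (L : CompleteLattice ℓ) where
  open CompleteLattice L

  Monotone : (Carrier → Carrier) → Set ℓ
  Monotone h = ∀ x y → x ≤ y → h x ≤ h y

  IsClosure : (Carrier → Carrier) → Set ℓ
  IsClosure u = Monotone u × (∀ x → x ≤ u x) × (∀ x → u (u x) ≈ u x)

  Compatible : (Carrier → Carrier) → (Carrier → Carrier) → Set ℓ
  Compatible f u = ∀ x → u (f x) ≤ f (u x)

  Directed : {I : Set ℓ} → (I → Carrier) → Set ℓ
  Directed {I} F = I × (∀ i j → ∃ λ k → F i ≤ F k × F j ≤ F k)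

  Continuous : (Carrier → Carrier) → Set (suc ℓ)
  Continuous h = ∀ {I : Set ℓ} (F : I → Carrier) → Directed F →
                 h (⋁ F) ≈ ⋁ (λ i → h (F i))

  Strict : (Carrier → Carrier) → Set ℓ
  Strict h = h ⊥L ≈ ⊥L

  -- u(L): the set of fixpoints of u (= image of the closure u)
  UL : (Carrier → Carrier) → Set ℓ
  UL u = Σ Carrier (λ x → u x ≈ x)

  incl : {u : Carrier → Carrier} → UL u → Carrier
  incl = proj₁

  SoundAbs : (u : Carrier → Carrier) → (Carrier → Carrier) → (UL u → UL u) → Set ℓ
  SoundAbs u h g = ∀ y → h (incl y) ≤ incl (g y)

  CompleteAbs : (u : Carrier → Carrier) → (Carrier → Carrier) → (UL u → UL u) → Set ℓ
  CompleteAbs u h g = ∀ y → incl (g y) ≤ h (incl y)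

  IsLfp : (Carrier → Carrier) → Carrier → Set ℓ
  IsLfp h x = h x ≈ x × (∀ y → h y ≈ y → x ≤ y)

  IsGfp : (Carrier → Carrier) → Carrier → Set ℓ
  IsGfp h x = h x ≈ x × (∀ y → h y ≈ y → y ≤ x)

  IsLfpU : (u : Carrier → Carrier) → (UL u → UL u) → UL u → Set ℓ
  IsLfpU u g x = incl (g x) ≈ incl x × (∀ y → incl (g y) ≈ incl y → incl x ≤ incl y)

  IsGfpU : (u : Carrier → Carrier) → (UL u → UL u) → UL u → Set ℓ
  IsGfpU u g x = incl (g x) ≈ incl x × (∀ y → incl (g y) ≈ incl y → incl y ≤ incl x)

-- The fixpoints of f ∘ u are exactly the u-closed fixpoints of f, which are
-- the fixpoints of f on u(L); so everything reduces to showing that the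
-- extremal fixpoints of f are u-closed. For νf this is because u(νf) is a
-- post-fixpoint of f, by compatibility. For μf we use fixpoint induction:
-- the predicate u x ⊑ x holds at ⊥ (strictness), is preserved by f
-- (compatibility) and by directed joins (continuity). Fixpoint induction is
-- proved constructively with Pataraia's theorem: the pointwise join of all
-- monotone inflationary maps on a dcpo is the largest one, hence absorbs f.
module Submission where

open import Defs
open import Level using (Level; suc)
open import Data.Product using (Σ; ∃; _×_; _,_; proj₁; proj₂)
open import Function using (_∘_)
open import Relation.Binary.Bundles using (Poset)

module CompleteLatticeProperties {ℓ : Level} (L : CompleteLattice ℓ) where
  open CompleteLattice L

  poset : Poset ℓ ℓ ℓ
  poset = record { isPartialOrder = isPartialOrder }

  open Poset poset public using (reflexive; antisym; module Eq)
    renaming (refl to ≤-refl; trans to ≤-trans)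

  ≥-reflexive : ∀ {x y} → x ≈ y → y ≤ x
  ≥-reflexive = reflexive ∘ Eq.sym

  ⊥L-least : ∀ x → ⊥L ≤ x
  ⊥L-least x = ⋁-least _ x (λ ())

  monotone⇒cong : ∀ {h} → Monotone L h → ∀ {x y} → x ≈ y → h x ≈ h y
  monotone⇒cong h-mono x≈y = antisym (h-mono _ _ (reflexive x≈y)) (h-mono _ _ (≥-reflexive x≈y))

  module _ {f : Carrier → Carrier} (f-mono : Monotone L f) where

    PostFixpoint : Set ℓ
    PostFixpoint = Σ Carrier (λ x → x ≤ f x)

    ν : Carrier
    ν = ⋁ {I = PostFixpoint} proj₁

    ν-post : ν ≤ f ν
    ν-post = ⋁-least proj₁ (f ν) (λ (x , x≤fx) → ≤-trans x≤fx (f-mono _ _ (⋁-upper proj₁ (x , x≤fx))))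

    ν-fixed : f ν ≈ ν
    ν-fixed = antisym (⋁-upper proj₁ (f ν , f-mono _ _ ν-post)) ν-post

    gfp-greatest-post : ∀ {a x} → IsGfp L f a → x ≤ f x → x ≤ a
    gfp-greatest-post {x = x} (_ , greatest) x≤fx = ≤-trans (⋁-upper proj₁ (x , x≤fx)) (greatest ν ν-fixed)

    record Admissible (P : Carrier → Set ℓ) : Set (suc ℓ) where
      field
        ⊥-closed : P ⊥L
        f-closed : ∀ {x} → P x → P (f x)
        ⋁-closed : ∀ {I : Set ℓ} (F : I → Carrier) → Directed L F → (∀ i → P (F i)) → P (⋁ F)

    open Admissible

    ∩-admissible : ∀ {P Q} → Admissible P → Admissible Q → Admissible (λ x → P x × Q x)
    ∩-admissible P Q = record
      { ⊥-closed = ⊥-closed P , ⊥-closed Q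
      ; f-closed = λ (p , q) → f-closed P p , f-closed Q q
      ; ⋁-closed = λ F F-dir PQ → ⋁-closed P F F-dir (proj₁ ∘ PQ) , ⋁-closed Q F F-dir (proj₂ ∘ PQ)
      }

    below-pre-admissible : ∀ {a} → f a ≤ a → Admissible (_≤ a)
    below-pre-admissible {a} fa≤a = record
      { ⊥-closed = ⊥L-least a
      ; f-closed = λ x≤a → ≤-trans (f-mono _ _ x≤a) fa≤a
      ; ⋁-closed = λ F _ → ⋁-least F a
      }

    post-admissible : Admissible (λ x → x ≤ f x)
    post-admissible = record
      { ⊥-closed = ⊥L-least (f ⊥L)
      ; f-closed = f-mono _ _
      ; ⋁-closed = λ F _ F-post → ⋁-least F _ (λ i → ≤-trans (F-post i) (f-mono _ _ (⋁-upper F i)))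
      }

    module Pataraia {P : Carrier → Set ℓ} (P-adm : Admissible P) (f-infl : ∀ {x} → P x → x ≤ f x) where

      record Expansion : Set ℓ where
        field
          map          : Carrier → Carrier
          preserves    : ∀ {x} → P x → P (map x)
          inflationary : ∀ {x} → P x → x ≤ map x
          monotone     : ∀ {x y} → P x → P y → x ≤ y → map x ≤ map y

      open Expansion

      identity : Expansion
      identity = record
        { map = λ x → x ; preserves = λ p → p ; inflationary = λ _ → ≤-refl ; monotone = λ _ _ x≤y → x≤y }

      _⊙_ : Expansion → Expansion → Expansion
      g ⊙ h = record
        { map          = map g ∘ map h
        ; preserves    = preserves g ∘ preserves h
        ; inflationary = λ p → ≤-trans (inflationary h p) (inflationary g (preserves h p))
        ; monotone     = λ p q x≤y → monotone g (preserves h p) (preserves h q) (monotone h p q x≤y)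
        }

      f-expansion : Expansion
      f-expansion = record
        { map = f ; preserves = f-closed P-adm ; inflationary = f-infl ; monotone = λ _ _ → f-mono _ _ }

      orbit : Carrier → Expansion → Carrier
      orbit x g = map g x

      orbit-directed : ∀ {x} → P x → Directed L (orbit x)
      orbit-directed p = identity , λ g h →
        g ⊙ h , monotone g p (preserves h p) (inflationary h p) , inflationary g (preserves h p)

      top : Expansion
      top = record
        { map          = λ x → ⋁ (orbit x)
        ; preserves    = λ p → ⋁-closed P-adm _ (orbit-directed p) (λ g → preserves g p)
        ; inflationary = λ {x} _ → ⋁-upper (orbit x) identity
        ; monotone     = λ {x} {y} p q x≤y → ⋁-least (orbit x) _
            (λ g → ≤-trans (monotone g p q x≤y) (⋁-upper (orbit y) g))
        }

      fixpoint : ∃ λ p → P p × f p ≈ p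
      fixpoint = map top ⊥L , P-top , antisym absorbs (f-infl P-top)
        where
        P-top = preserves top (⊥-closed P-adm)
        absorbs : f (map top ⊥L) ≤ map top ⊥L
        absorbs = ⋁-upper (orbit ⊥L) (f-expansion ⊙ top)

    lfp-induction : ∀ {a P} → IsLfp L f a → Admissible P → ∃ λ p → P p × p ≈ a
    lfp-induction {a} {P} (fa≈a , least) P-adm =
      let p , (Pp , p≤a , _) , fp≈p = Pataraia.fixpoint below-a-post-adm (proj₂ ∘ proj₂)
      in  p , Pp , antisym p≤a (least p fp≈p)
      where
      -- On post-fixpoints f is inflationary, and below a the fixpoint found must be a.
      below-a-post-adm : Admissible (λ x → P x × x ≤ a × x ≤ f x)
      below-a-post-adm = ∩-admissible P-adm (∩-admissible (below-pre-admissible (reflexive fa≈a)) post-admissible)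

  module Closure (f u : Carrier → Carrier) (f-mono : Monotone L f) (u-closure : IsClosure L u)
                 (compatible : Compatible L f u) where

    u-mono : Monotone L u
    u-mono = proj₁ u-closure

    u-extensive : ∀ x → x ≤ u x
    u-extensive = proj₁ (proj₂ u-closure)

    u-idempotent : ∀ x → u (u x) ≈ u x
    u-idempotent = proj₂ (proj₂ u-closure)

    closed-from-≤ : ∀ {x} → u x ≤ x → u x ≈ x
    closed-from-≤ {x} ux≤x = antisym ux≤x (u-extensive x)

    f-preserves-closed : ∀ x → u x ≈ x → u (f x) ≈ f x
    f-preserves-closed x ux≈x = closed-from-≤ (≤-trans (compatible x) (f-mono _ _ (reflexive ux≈x)))

    fU : UL L u → UL L u
    fU y = f (incl L y) , f-preserves-closed (incl L y) (proj₂ y)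

    f∘u≈f-on-closed : ∀ (y : UL L u) → f (u (incl L y)) ≈ f (incl L y)
    f∘u≈f-on-closed (_ , uy≈y) = monotone⇒cong f-mono uy≈y

    f∘u-fixpoint-closed : ∀ {c} → f (u c) ≈ c → u c ≈ c
    f∘u-fixpoint-closed {c} fuc≈c = closed-from-≤ (begin
      u c           ≤⟨ u-mono _ _ (≥-reflexive fuc≈c) ⟩
      u (f (u c))   ≤⟨ compatible (u c) ⟩
      f (u (u c))   ≤⟨ f-mono _ _ (reflexive (u-idempotent c)) ⟩
      f (u c)       ≈⟨ fuc≈c ⟩
      c             ∎)
      where open import Relation.Binary.Reasoning.PartialOrder poset

    gfp-closed : ∀ {a} → IsGfp L f a → u a ≈ a
    gfp-closed {a} a-gfp@(fa≈a , _) =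
      closed-from-≤ (gfp-greatest-post f-mono a-gfp (≤-trans (u-mono _ _ (≥-reflexive fa≈a)) (compatible a)))

    closed-admissible : Continuous L u → Strict L u → Admissible f-mono (λ x → u x ≤ x)
    closed-admissible continuous strict = record
      { ⊥-closed = reflexive strict
      ; f-closed = λ {x} ux≤x → ≤-trans (compatible x) (f-mono _ _ ux≤x)
      ; ⋁-closed = λ F F-dir uF≤F → ≤-trans (reflexive (continuous F F-dir))
                                      (⋁-least _ _ (λ i → ≤-trans (uF≤F i) (⋁-upper F i)))
      }

    lfp-closed : Continuous L u → Strict L u → ∀ {a} → IsLfp L f a → u a ≈ a
    lfp-closed continuous strict a-lfp =
      let p , up≤p , p≈a = lfp-induction f-mono a-lfp (closed-admissible continuous strict)
      in  closed-from-≤ (≤-trans (u-mono _ _ (≥-reflexive p≈a)) (≤-trans up≤p (reflexive p≈a)))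

    gfp≈gfpU : ∀ a b → IsGfp L f a → IsGfpU L u fU b → a ≈ incl L b
    gfp≈gfpU a _ a-gfp@(fa≈a , a-greatest) (fb≈b , b-greatest) =
      antisym (b-greatest (a , gfp-closed a-gfp) fa≈a) (a-greatest _ fb≈b)

    lfp≈lfpU : Continuous L u → Strict L u → ∀ a b → IsLfp L f a → IsLfpU L u fU b → a ≈ incl L b
    lfp≈lfpU continuous strict a _ a-lfp@(fa≈a , a-least) (fb≈b , b-least) =
      antisym (a-least _ fb≈b) (b-least (a , lfp-closed continuous strict a-lfp) fa≈a)

    gfpU≈gfp∘u : ∀ b c → IsGfpU L u fU b → IsGfp L (f ∘ u) c → incl L b ≈ c
    gfpU≈gfp∘u b c (fb≈b , b-greatest) (fuc≈c , c-greatest) =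
      antisym (c-greatest _ (Eq.trans (f∘u≈f-on-closed b) fb≈b))
              (b-greatest (c , uc≈c) (Eq.trans (Eq.sym (f∘u≈f-on-closed (c , uc≈c))) fuc≈c))
      where uc≈c = f∘u-fixpoint-closed fuc≈c

    lfpU≈lfp∘u : ∀ b c → IsLfpU L u fU b → IsLfp L (f ∘ u) c → incl L b ≈ c
    lfpU≈lfp∘u b c (fb≈b , b-least) (fuc≈c , c-least) =
      antisym (b-least (c , uc≈c) (Eq.trans (Eq.sym (f∘u≈f-on-closed (c , uc≈c))) fuc≈c))
              (c-least _ (Eq.trans (f∘u≈f-on-closed b) fb≈b))
      where uc≈c = f∘u-fixpoint-closed fuc≈c

lemma5p3 : {ℓ : Level} (L : CompleteLattice ℓ) →
    let open CompleteLattice L in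
    (f u : Carrier → Carrier) →
    Monotone L f → IsClosure L u → Compatible L f u →
    Σ (∀ x → u x ≈ x → u (f x) ≈ f x) λ restr →
      let fU : UL L u → UL L u
          fU = λ y → f (incl L y) , restr (incl L y) (Σ.proj₂ y)
      in (SoundAbs L u f fU × CompleteAbs L u f fU)
       × (SoundAbs L u (f ∘ u) fU × CompleteAbs L u (f ∘ u) fU)
       × (∀ a b c → IsGfp L f a → IsGfpU L u fU b → IsGfp L (f ∘ u) c →
            (a ≈ incl L b) × (incl L b ≈ c))
       × (Continuous L u → Strict L u →
            ∀ a b c → IsLfp L f a → IsLfpU L u fU b → IsLfp L (f ∘ u) c →
            (a ≈ incl L b) × (incl L b ≈ c))
lemma5p3 L f u f-mono u-closure compatible =
  f-preserves-closed ,
  ((λ _ → ≤-refl) , (λ _ → ≤-refl)) ,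
  ((λ y → reflexive (f∘u≈f-on-closed y)) , (λ y → ≥-reflexive (f∘u≈f-on-closed y))) ,
  (λ a b c a-gfp b-gfp c-gfp → gfp≈gfpU a b a-gfp b-gfp , gfpU≈gfp∘u b c b-gfp c-gfp) ,
  (λ continuous strict a b c a-lfp b-lfp c-lfp →
     lfp≈lfpU continuous strict a b a-lfp b-lfp , lfpU≈lfp∘u b c b-lfp c-lfp)
  where
  open CompleteLatticeProperties L
  open Closure f u f-mono u-closure compatible
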